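{- Let $m\ge 2$ and $n\ge 1$ be integers and let $\pi=\pi_1\cdots\pi_n\in\mathcal{S}_n$. Then ${\sf a}_m(\pi)$ equals the number of diagram squares of $\pi$ of rank at least $m-2$. In particular, $\pi$ avoids every pattern of $A_m$ if and only if every diagram square of $\pi$ has rank at most $m-3$.
   Context: For $\tau\in\mathcal{S}_m$, an occurrence of $\tau$ in $\pi\in\mathcal{S}_n$ is a sequence $1\le i_1<\dots<i_m\le n$ such that $\pi_{i_1}\cdots\pi_{i_m}$ is order-isomorphic to $\tau$; $\pi$ avoids $\tau$ if there is no occurrence. Let $A_m=\{\tau\in\mathcal{S}_m:\tau_{m-1}=m,\ \tau_m=m-1\}$ and $B_m=\{\tau\in\mathcal{S}_m:\tau_{m-1}=m-1,\ \tau_m=m\}$. ${\sf a}_m(\pi)$ (resp. ${\sf b}_m(\pi)$) is the number of distinct pairs $(i,j)$, $1\le i<j\le n$, such that $i,j$ are the final two terms of some occurrence in $\pi$ of some pattern belonging to $A_m$ (resp. $B_m$). The diagram of $\pi$: in an $n\times n$ array with rows $1,\dots,n$ from top to bottom and columns $1,\dots,n$ from left to right, place a dot in cell $(i,\pi_i)$ for each $i$, and shade each dotted cell together with all cells due south (same column, larger row index) and due east (same row, larger column index) of it. The unshaded cells are the diagram squares; equivalently, $(i,j)$ is a diagram square iff $j<\pi_i$ and $\pi^{ -1}(j)>i$. The rank of a diagram square $(i,j)$ is the number of dots strictly northwest of it, i.e. $|\{k<i:\pi_k<j\}|$. -}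

module Defs where

open import Level using (Level; _⊔_)
open import Data.Nat using (ℕ; _<_; _≤_; _∸_; _+_)
open import Data.Nat.Properties using (_<?_)
open import Data.Fin using (Fin; toℕ)
open import Data.Fin.Permutation using (Permutation′; _⟨$⟩ʳ_; _⟨$⟩ˡ_)
open import Data.List using (List; length; filter; allFin)
open import Data.List.Relation.Unary.Unique.Propositional using (Unique)
open import Data.List.Membership.Propositional using (_∈_)
open import Data.Product using (Σ; ∃; _×_; _,_)
open import Relation.Nullary.Decidable using (_×-dec_)
open import Relation.Nullary using (¬_)
open import Relation.Binary.PropositionalEquality using (_≡_)
open import Function.Bundles using (_⇔_)

-- Conventions: positions and values are 0-based elements of Fin n;
-- the paper's π_i (1-based) corresponds to π ⟨$⟩ʳ i here, and order
-- comparisons are done via toℕ.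

_at_ : ∀ {n} → Permutation′ n → Fin n → Fin n
π at i = π ⟨$⟩ʳ i

HasCard : ∀ {a p} {A : Set a} → (A → Set p) → ℕ → Set (a ⊔ p)
HasCard {A = A} P k =
  Σ (List A) λ xs → Unique xs × (length xs ≡ k) × (∀ x → (x ∈ xs) ⇔ P x)

IsOccurrence : ∀ {m n} → Permutation′ m → Permutation′ n → (Fin m → Fin n) → Set
IsOccurrence {m} {n} τ π idx =
  (∀ a b → toℕ a < toℕ b → toℕ (idx a) < toℕ (idx b)) ×
  (∀ a b → (toℕ (π at (idx a)) < toℕ (π at (idx b))) ⇔ (toℕ (τ at a) < toℕ (τ at b)))

Contains : ∀ {m n} → Permutation′ m → Permutation′ n → Set
Contains τ π = ∃ λ idx → IsOccurrence τ π idx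

-- τ ∈ A_m : τ_{m-1} = m and τ_m = m-1 (1-based); 0-based: the entry in
-- position m-2 has value m-1 and the entry in position m-1 has value m-2.
InA : ∀ {m} → Permutation′ m → Set
InA {m} τ =
  (∀ a → toℕ a ≡ m ∸ 2 → toℕ (τ at a) ≡ m ∸ 1) ×
  (∀ a → toℕ a ≡ m ∸ 1 → toℕ (τ at a) ≡ m ∸ 2)

IsAPair : (m : ℕ) → ∀ {n} → Permutation′ n → Fin n × Fin n → Set
IsAPair m {n} π (i , j) =
  (toℕ i < toℕ j) ×
  (Σ (Permutation′ m) λ τ → InA τ × (Σ (Fin m → Fin n) λ idx →
     IsOccurrence τ π idx ×
     (∃ λ a → toℕ a ≡ m ∸ 2 × idx a ≡ i) ×
     (∃ λ b → toℕ b ≡ m ∸ 1 × idx b ≡ j)))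

AmCount : (m : ℕ) → ∀ {n} → Permutation′ n → ℕ → Set
AmCount m π k = HasCard (IsAPair m π) k

IsDiagramSquare : ∀ {n} → Permutation′ n → Fin n → Fin n → Set
IsDiagramSquare π i j = (toℕ j < toℕ (π at i)) × (toℕ i < toℕ (π ⟨$⟩ˡ j))

rank : ∀ {n} → Permutation′ n → Fin n → Fin n → ℕ
rank {n} π i j =
  length (filter (λ k → (toℕ k <? toℕ i) ×-dec (toℕ (π at k) <? toℕ j)) (allFin n))

IsHighRankSquare : (m : ℕ) → ∀ {n} → Permutation′ n → Fin n × Fin n → Set
IsHighRankSquare m π (i , j) = IsDiagramSquare π i j × (m ≤ rank π i j + 2)

AvoidsA : (m : ℕ) → ∀ {n} → Permutation′ n → Set
AvoidsA m π = ∀ (τ : Permutation′ m) → InA τ → ¬ Contains τ π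

{-# OPTIONS --safe #-}
module Submission where

open import Defs
open import Level using (0ℓ)
open import Data.Nat using (ℕ; zero; suc; _+_; _≤_; _<_; _≤?_; z≤n; s≤s; s≤s⁻¹; z<s)
open import Data.Nat.Properties
  using (_<?_; <-cmp; ≤-refl; ≤-trans; <-irrefl; <-asym; <-trans; <⇒≢; <⇒≱; ≤∧≢⇒<; ≰⇒>;
         m≤n⇒m≤1+n; m<n⇒m<1+n; n<1+n; m≤n+m; 1+n≰n; +-comm; +-suc)
open import Data.Fin using (Fin; zero; suc; toℕ; fromℕ; fromℕ<; inject₁; punchOut)
open import Data.Fin.Properties
  using (toℕ-injective; toℕ<n; toℕ-fromℕ; toℕ-fromℕ<; toℕ-inject₁; inject₁-injective; suc-injective;
         _≟_; any?; punchOut-injective; injective⇒≤)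
open import Data.Fin.Relation.Unary.Top using (view; view-fromℕ; view-inject₁; ‵fromℕ; ‵inj₁)
open import Data.Fin.Permutation using (Permutation′; _⟨$⟩ˡ_; permutation; inverseˡ)
open import Data.List using (List; []; _∷_; length; filter; allFin; tabulate; lookup; map)
open import Data.List.Properties using (length-map)
open import Data.List.Membership.Propositional using (_∈_)
open import Data.List.Membership.Propositional.Properties
  using (∈-allFin; ∈-filter⁺; ∈-filter⁻; ∈-map⁺; ∈-map⁻; ∈-cartesianProduct⁺)
open import Data.List.Relation.Unary.Any using (here; index)
open import Data.List.Relation.Unary.Any.Properties using (lookup-index; ¬Any[])
open import Data.List.Relation.Unary.Unique.Propositional using (Unique)
open import Data.List.Relation.Unary.Unique.Propositional.Properties
  using (allFin⁺; filter⁺; map⁺; cartesianProduct⁺)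
open import Data.Product using (Σ; ∃; _×_; _,_; proj₁; proj₂)
open import Data.Product.Function.NonDependent.Propositional using (_×-↔_)
open import Function using (_∘_; id)
open import Function.Bundles using (_⇔_; mk⇔; Equivalence; _↔_; Inverse; Injection)
open import Function.Construct.Composition using (_⇔-∘_)
open import Function.Construct.Identity using (↔-id)
open import Function.Construct.Symmetry using (↔-sym)
open import Function.Definitions using (Injective)
open import Function.Properties.Equivalence using (⇔-setoid)
open import Function.Properties.Inverse using (↔⇒↣)
open import Relation.Binary using (tri<; tri≈; tri>)
open import Relation.Binary.PropositionalEquality
  using (_≡_; _≢_; refl; sym; trans; cong; subst; subst₂; module ≡-Reasoning)
import Relation.Binary.Reasoning.Setoid as SetoidReasoning
open import Relation.Nullary using (¬_; yes; no; contradiction)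
open import Relation.Nullary.Decidable using (_×-dec_)
open import Relation.Unary using (Pred; Decidable; Empty; _⊆_; _≐_)

-- With m = k + 2, a pair i < j ends an occurrence of a pattern of A_m exactly when
-- π_j < π_i and at least k positions l < i have π_l < π_j, i.e. when the square
-- (i, π_j) has rank at least k.  Given such an occurrence, its first k entries are
-- such positions, since the pattern puts its two largest values last.  Conversely,
-- any k such positions, in increasing order and followed by i and j, form an
-- occurrence of their own standardisation, which lies in A_m because the k earlier
-- values are below π_j < π_i.  The bijection (i, j) ↦ (i, π_j) carries inversions
-- onto diagram squares, so the two counts agree, and π avoids A_m iff both vanish.

-- Counting in Fin n

count : ∀ {n} {P : Pred (Fin n) 0ℓ} → Decidable P → ℕ
count {zero}  P? = 0
count {suc n} P? with P? zero
... | yes _ = suc (count (P? ∘ suc))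
... | no  _ = count (P? ∘ suc)

length-filter-tabulate : ∀ {n} {A : Set} {P : Pred A 0ℓ} (P? : Decidable P) (f : Fin n → A) →
  length (filter P? (tabulate f)) ≡ count (P? ∘ f)
length-filter-tabulate {zero}  P? f = refl
length-filter-tabulate {suc n} P? f with P? (f zero)
... | yes _ = cong suc (length-filter-tabulate P? (f ∘ suc))
... | no  _ = length-filter-tabulate P? (f ∘ suc)

count≤n : ∀ {n} {P : Pred (Fin n) 0ℓ} (P? : Decidable P) → count P? ≤ n
count≤n {zero}  P? = z≤n
count≤n {suc n} P? with P? zero
... | yes _ = s≤s (count≤n (P? ∘ suc))
... | no  _ = m≤n⇒m≤1+n (count≤n (P? ∘ suc))

count<n : ∀ {n} {P : Pred (Fin n) 0ℓ} (P? : Decidable P) {x} → ¬ P x → count P? < n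
count<n {suc n} P? {zero} ¬Px with P? zero
... | yes Px = contradiction Px ¬Px
... | no  _  = s≤s (count≤n (P? ∘ suc))
count<n {suc n} P? {suc x} ¬Px with P? zero
... | yes _ = s≤s (count<n (P? ∘ suc) ¬Px)
... | no  _ = m<n⇒m<1+n (count<n (P? ∘ suc) ¬Px)

count-mono : ∀ {n} {P Q : Pred (Fin n) 0ℓ} (P? : Decidable P) (Q? : Decidable Q) →
  P ⊆ Q → count P? ≤ count Q?
count-mono {zero}  P? Q? P⊆Q = z≤n
count-mono {suc n} P? Q? P⊆Q with P? zero | Q? zero
... | yes _  | yes _  = s≤s (count-mono (P? ∘ suc) (Q? ∘ suc) P⊆Q)
... | yes Px | no ¬Qx = contradiction (P⊆Q Px) ¬Qx
... | no  _  | yes _  = m≤n⇒m≤1+n (count-mono (P? ∘ suc) (Q? ∘ suc) P⊆Q)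
... | no  _  | no  _  = count-mono (P? ∘ suc) (Q? ∘ suc) P⊆Q

count-mono-< : ∀ {n} {P Q : Pred (Fin n) 0ℓ} (P? : Decidable P) (Q? : Decidable Q) →
  P ⊆ Q → ∀ {x} → Q x → ¬ P x → count P? < count Q?
count-mono-< {suc n} P? Q? P⊆Q {zero} Qx ¬Px with P? zero | Q? zero
... | yes Px | _      = contradiction Px ¬Px
... | no  _  | yes _  = s≤s (count-mono (P? ∘ suc) (Q? ∘ suc) P⊆Q)
... | no  _  | no ¬Qx = contradiction Qx ¬Qx
count-mono-< {suc n} P? Q? P⊆Q {suc x} Qx ¬Px with P? zero | Q? zero
... | yes _  | yes _  = s≤s (count-mono-< (P? ∘ suc) (Q? ∘ suc) P⊆Q Qx ¬Px)
... | yes Px | no ¬Qx = contradiction (P⊆Q Px) ¬Qx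
... | no  _  | yes _  = m<n⇒m<1+n (count-mono-< (P? ∘ suc) (Q? ∘ suc) P⊆Q Qx ¬Px)
... | no  _  | no  _  = count-mono-< (P? ∘ suc) (Q? ∘ suc) P⊆Q Qx ¬Px

count-initial : ∀ {n} {P : Pred (Fin n) 0ℓ} (P? : Decidable P) {t} → t ≤ n →
  P ≐ (λ x → toℕ x < t) → count P? ≡ t
count-initial {zero}  P? {zero}  _         _ = refl
count-initial {suc n} P? {zero}  _         (P⊆ , _) with P? zero
... | yes P0 = contradiction (P⊆ P0) λ ()
... | no  _  = count-initial (P? ∘ suc) z≤n ((λ Px → contradiction (P⊆ Px) λ ()) , λ ())
count-initial {suc n} P? {suc t} (s≤s t≤n) (P⊆ , ⊆P) with P? zero
... | yes _   = cong suc (count-initial (P? ∘ suc) t≤n ((s≤s⁻¹ ∘ P⊆) , (⊆P ∘ s≤s)))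
... | no  ¬P0 = contradiction (⊆P z<s) ¬P0

count-all-but : ∀ {n} {P : Pred (Fin (suc n)) 0ℓ} (P? : Decidable P) {a} →
  P ≐ (_≢ a) → count P? ≡ n
count-all-but P? {zero} (P⊆ , ⊆P) with P? zero
... | yes P0 = contradiction refl (P⊆ P0)
... | no  _  = count-initial (P? ∘ suc) ≤-refl ((λ {x} _ → toℕ<n x) , λ _ → ⊆P λ ())
count-all-but {suc n} P? {suc a} (P⊆ , ⊆P) with P? zero
... | yes _   =
  cong suc (count-all-but (P? ∘ suc) ((λ Px → P⊆ Px ∘ cong suc) , (λ x≢a → ⊆P (x≢a ∘ suc-injective))))
... | no  ¬P0 = contradiction (⊆P λ ()) ¬P0

injective⇒≤count : ∀ {k n} {P : Pred (Fin n) 0ℓ} (P? : Decidable P) (g : Fin k → Fin n) →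
  Injective _≡_ _≡_ g → (∀ c → P (g c)) → k ≤ count P?
injective⇒≤count {k} {n} P? g g-injective Pg =
  subst (k ≤_) (length-filter-tabulate P? id) (injective⇒≤ position-injective)
  where
  selected : List (Fin n)
  selected = filter P? (allFin n)
  g∈selected : ∀ c → g c ∈ selected
  g∈selected c = ∈-filter⁺ P? (∈-allFin (g c)) (Pg c)
  position : Fin k → Fin (length selected)
  position c = index (g∈selected c)
  position-injective : Injective _≡_ _≡_ position
  position-injective {a} {b} pa≡pb = g-injective (begin
    g a                          ≡⟨ lookup-index (g∈selected a) ⟩
    lookup selected (position a) ≡⟨ cong (lookup selected) pa≡pb ⟩
    lookup selected (position b) ≡⟨ lookup-index (g∈selected b) ⟨
    g b                          ∎)
    where open ≡-Reasoning

Increasing : ∀ {k n} → (Fin k → Fin n) → Set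
Increasing f = ∀ a b → toℕ a < toℕ b → toℕ (f a) < toℕ (f b)

increasing⇒injective : ∀ {k n} {f : Fin k → Fin n} → Increasing f → Injective _≡_ _≡_ f
increasing⇒injective f-increasing {a} {b} fa≡fb with <-cmp (toℕ a) (toℕ b)
... | tri< a<b _ _ = contradiction (cong toℕ fa≡fb) (<⇒≢ (f-increasing a b a<b))
... | tri≈ _ a≡b _ = toℕ-injective a≡b
... | tri> _ _ b<a = contradiction (cong toℕ (sym fa≡fb)) (<⇒≢ (f-increasing b a b<a))

increasing-selection : ∀ {n} {P : Pred (Fin n) 0ℓ} (P? : Decidable P) {r} → r ≤ count P? →
  Σ (Fin r → Fin n) λ g → Increasing g × (∀ c → P (g c))
increasing-selection {zero}  P? {zero} _ = (λ ()) , (λ ()) , (λ ())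
increasing-selection {suc n} {P} P? {r} r≤count with P? zero
increasing-selection {suc n} {P} P? {zero}  _             | yes _ = (λ ()) , (λ ()) , (λ ())
increasing-selection {suc n} {P} P? {suc r} (s≤s r≤count) | yes P0
  with g , g-increasing , Pg ← increasing-selection (P? ∘ suc) r≤count = g′ , g′-increasing , Pg′
  where
  g′ : Fin (suc r) → Fin (suc n)
  g′ zero    = zero
  g′ (suc c) = suc (g c)
  g′-increasing : Increasing g′
  g′-increasing zero    (suc b) _         = z<s
  g′-increasing (suc a) (suc b) (s≤s a<b) = s≤s (g-increasing a b a<b)
  Pg′ : ∀ c → P (g′ c)
  Pg′ zero    = P0
  Pg′ (suc c) = Pg c
... | no _ with g , g-increasing , Pg ← increasing-selection (P? ∘ suc) r≤count =
  suc ∘ g , (λ a b a<b → s≤s (g-increasing a b a<b)) , Pg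

-- Standardisation

injective⇒surjective : ∀ {n} {f : Fin n → Fin n} → Injective _≡_ _≡_ f → ∀ y → ∃ λ x → f x ≡ y
injective⇒surjective {suc n} {f} f-injective y with any? (λ x → f x ≟ y)
... | yes hit  = hit
... | no  miss = contradiction (injective⇒≤ squeeze-injective) 1+n≰n
  where
  y≢f : ∀ x → y ≢ f x
  y≢f x y≡fx = miss (x , sym y≡fx)
  squeeze : Fin (suc n) → Fin n
  squeeze x = punchOut (y≢f x)
  squeeze-injective : Injective _≡_ _≡_ squeeze
  squeeze-injective eq = f-injective (punchOut-injective (y≢f _) (y≢f _) eq)

injective⇒permutation : ∀ {n} (f : Fin n → Fin n) → Injective _≡_ _≡_ f → Permutation′ n
injective⇒permutation f f-injective =
  permutation f (proj₁ ∘ surjective) (proj₂ ∘ surjective) (f-injective ∘ proj₂ ∘ surjective ∘ f)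
  where surjective = injective⇒surjective f-injective

module Standardisation {N} (v : Fin N → ℕ) (v-injective : Injective _≡_ _≡_ v) where

  below? : ∀ a → Decidable (λ b → v b < v a)
  below? a b = v b <? v a

  stdRank : Fin N → ℕ
  stdRank a = count (below? a)

  stdRank<N : ∀ a → stdRank a < N
  stdRank<N a = count<n (below? a) (<-irrefl refl)

  stdRank-mono : ∀ {a b} → v a < v b → stdRank a < stdRank b
  stdRank-mono va<vb =
    count-mono-< (below? _) (below? _) (λ vc<va → <-trans vc<va va<vb) va<vb (<-irrefl refl)

  stdRank-reflects : ∀ {a b} → stdRank a < stdRank b → v a < v b
  stdRank-reflects {a} {b} ra<rb with <-cmp (v a) (v b)
  ... | tri< va<vb _ _ = va<vb
  ... | tri≈ _ va≡vb _ = contradiction (cong stdRank (v-injective va≡vb)) (<⇒≢ ra<rb)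
  ... | tri> _ _ vb<va = contradiction (stdRank-mono vb<va) (<-asym ra<rb)

  stdRank-injective : Injective _≡_ _≡_ stdRank
  stdRank-injective {a} {b} ra≡rb with <-cmp (v a) (v b)
  ... | tri< va<vb _ _ = contradiction ra≡rb (<⇒≢ (stdRank-mono va<vb))
  ... | tri≈ _ va≡vb _ = v-injective va≡vb
  ... | tri> _ _ vb<va = contradiction (sym ra≡rb) (<⇒≢ (stdRank-mono vb<va))

  stdPosition : Fin N → Fin N
  stdPosition a = fromℕ< (stdRank<N a)

  toℕ-stdPosition : ∀ a → toℕ (stdPosition a) ≡ stdRank a
  toℕ-stdPosition a = toℕ-fromℕ< (stdRank<N a)

  stdPosition-injective : Injective _≡_ _≡_ stdPosition
  stdPosition-injective {a} {b} eq =
    stdRank-injective (trans (sym (toℕ-stdPosition a)) (trans (cong toℕ eq) (toℕ-stdPosition b)))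

  standardise : Permutation′ N
  standardise = injective⇒permutation stdPosition stdPosition-injective

  toℕ-standardise : ∀ a → toℕ (standardise at a) ≡ stdRank a
  toℕ-standardise = toℕ-stdPosition

  standardise-iso : ∀ a b → (v a < v b) ⇔ (toℕ (standardise at a) < toℕ (standardise at b))
  standardise-iso a b = mk⇔
    (λ va<vb → subst₂ _<_ (sym (toℕ-standardise a)) (sym (toℕ-standardise b)) (stdRank-mono va<vb))
    (λ τa<τb → stdRank-reflects (subst₂ _<_ (toℕ-standardise a) (toℕ-standardise b) τa<τb))

infixl 5 _∷ʳ_

_∷ʳ_ : ∀ {k} {A : Set} → (Fin k → A) → A → Fin (suc k) → A
(f ∷ʳ x) c with view c
... | ‵fromℕ            = x
... | ‵inj₁ {i = c′} _ = f c′

∷ʳ-fromℕ : ∀ {k} {A : Set} (f : Fin k → A) (x : A) → (f ∷ʳ x) (fromℕ k) ≡ x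
∷ʳ-fromℕ {k} f x rewrite view-fromℕ k = refl

∷ʳ-inject₁ : ∀ {k} {A : Set} (f : Fin k → A) (x : A) c → (f ∷ʳ x) (inject₁ c) ≡ f c
∷ʳ-inject₁ f x c rewrite view-inject₁ c = refl

∷ʳ-increasing : ∀ {k n} {f : Fin k → Fin n} {x} →
  Increasing f → (∀ c → toℕ (f c) < toℕ x) → Increasing (f ∷ʳ x)
∷ʳ-increasing {k} f-increasing f<x a b a<b with view a | view b
... | ‵fromℕ            | _                =
  contradiction (s≤s⁻¹ (toℕ<n b)) (<⇒≱ (subst (_< toℕ b) (toℕ-fromℕ k) a<b))
... | ‵inj₁ {i = a′} _ | ‵fromℕ           = f<x a′
... | ‵inj₁ {i = a′} _ | ‵inj₁ {i = b′} _ =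
  f-increasing a′ b′ (subst₂ _<_ (toℕ-inject₁ a′) (toℕ-inject₁ b′) a<b)

early : ∀ {k} → Fin k → Fin (2 + k)
early c = inject₁ (inject₁ c)

toℕ-early< : ∀ {k} (c : Fin k) → toℕ (early c) < k
toℕ-early< c = subst (_< _) (sym (trans (toℕ-inject₁ (inject₁ c)) (toℕ-inject₁ c))) (toℕ<n c)

penultimate : ∀ k → Fin (2 + k)
penultimate k = inject₁ (fromℕ k)

toℕ-penultimate : ∀ k → toℕ (penultimate k) ≡ k
toℕ-penultimate k = trans (toℕ-inject₁ (fromℕ k)) (toℕ-fromℕ k)

-- A-pairs as ranked inversions

inA-initial : ∀ {k} (τ : Permutation′ (2 + k)) → InA τ → ∀ c → toℕ c < k → toℕ (τ at c) < k
inA-initial {k} τ (τ-penultimate , τ-last) c c<k =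
  ≤∧≢⇒< (s≤s⁻¹ (≤∧≢⇒< (s≤s⁻¹ (toℕ<n (τ at c))) τc≢1+k)) τc≢k
  where
  differs : ∀ {a} → toℕ c < toℕ a → toℕ (τ at c) ≢ toℕ (τ at a)
  differs c<a τc≡τa = <⇒≢ c<a (cong toℕ (Injection.injective (↔⇒↣ τ) (toℕ-injective τc≡τa)))
  τc≢1+k : toℕ (τ at c) ≢ suc k
  τc≢1+k eq = differs (subst (toℕ c <_) (sym (toℕ-penultimate k)) c<k)
                      (trans eq (sym (τ-penultimate (penultimate k) (toℕ-penultimate k))))
  τc≢k : toℕ (τ at c) ≢ k
  τc≢k eq = differs (subst (toℕ c <_) (sym (toℕ-fromℕ (suc k))) (m<n⇒m<1+n c<k))
                    (trans eq (sym (τ-last (fromℕ (suc k)) (toℕ-fromℕ (suc k)))))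

NorthWest : ∀ {n} → Permutation′ n → Fin n → Fin n → Pred (Fin n) 0ℓ
NorthWest π i j l = toℕ l < toℕ i × toℕ (π at l) < toℕ j

northWest? : ∀ {n} (π : Permutation′ n) i j → Decidable (NorthWest π i j)
northWest? π i j l = (toℕ l <? toℕ i) ×-dec (toℕ (π at l) <? toℕ j)

rank≡count : ∀ {n} (π : Permutation′ n) i j → rank π i j ≡ count (northWest? π i j)
rank≡count π i j = length-filter-tabulate (northWest? π i j) id

IsRankedInversion : ℕ → ∀ {n} → Permutation′ n → Fin n × Fin n → Set
IsRankedInversion k π (i , j) = toℕ i < toℕ j × toℕ (π at j) < toℕ (π at i) × k ≤ rank π i (π at j)

isAPair⇒isRankedInversion : ∀ {k n} {π : Permutation′ n} {x} →
  IsAPair (2 + k) π x → IsRankedInversion k π x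
isAPair⇒isRankedInversion {k} {π = π} {i , j}
  (i<j , τ , τ∈A@(τ-penultimate , τ-last) , idx , (idx-increasing , idx-iso) ,
   (a , a≡k , refl) , (b , b≡1+k , refl)) =
  i<j , πj<πi , subst (k ≤_) (sym (rank≡count π i (π at j)))
                      (injective⇒≤count _ (idx ∘ early) early-injective early-northWest)
  where
  πj<πi : toℕ (π at j) < toℕ (π at i)
  πj<πi = Equivalence.from (idx-iso b a)
    (subst₂ _<_ (sym (τ-last b b≡1+k)) (sym (τ-penultimate a a≡k)) (n<1+n k))
  early-injective : Injective _≡_ _≡_ (idx ∘ early)
  early-injective = inject₁-injective ∘ inject₁-injective ∘ increasing⇒injective idx-increasing
  early-northWest : ∀ c → NorthWest π i (π at j) (idx (early c))
  early-northWest c =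
    idx-increasing (early c) a (subst (toℕ (early c) <_) (sym a≡k) (toℕ-early< c)) ,
    Equivalence.from (idx-iso (early c) b)
      (subst (toℕ (τ at early c) <_) (sym (τ-last b b≡1+k))
             (inA-initial τ τ∈A (early c) (toℕ-early< c)))

module OccurrenceOfRankedInversion {k n} (π : Permutation′ n) {i j : Fin n}
  (i<j : toℕ i < toℕ j) (πj<πi : toℕ (π at j) < toℕ (π at i))
  (g : Fin k → Fin n) (g-increasing : Increasing g)
  (g-northWest : ∀ c → NorthWest π i (π at j) (g c)) where

  idx : Fin (2 + k) → Fin n
  idx = g ∷ʳ i ∷ʳ j

  idx-penultimate : idx (penultimate k) ≡ i
  idx-penultimate = trans (∷ʳ-inject₁ (g ∷ʳ i) j (fromℕ k)) (∷ʳ-fromℕ g i)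

  idx-last : idx (fromℕ (suc k)) ≡ j
  idx-last = ∷ʳ-fromℕ (g ∷ʳ i) j

  idx-increasing : Increasing idx
  idx-increasing = ∷ʳ-increasing (∷ʳ-increasing g-increasing (proj₁ ∘ g-northWest)) before-j
    where
    before-j : ∀ c → toℕ ((g ∷ʳ i) c) < toℕ j
    before-j c with view c
    ... | ‵fromℕ            = i<j
    ... | ‵inj₁ {i = c′} _ = <-trans (proj₁ (g-northWest c′)) i<j

  value : Fin (2 + k) → ℕ
  value b = toℕ (π at idx b)

  value-injective : Injective _≡_ _≡_ value
  value-injective = increasing⇒injective idx-increasing ∘ Injection.injective (↔⇒↣ π) ∘ toℕ-injective

  below-πi : ∀ b → b ≢ penultimate k → value b < toℕ (π at i)
  below-πi b b≢penultimate with view b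
  ... | ‵fromℕ = πj<πi
  ... | ‵inj₁ {i = c} _ with view c
  ...   | ‵fromℕ            = contradiction refl b≢penultimate
  ...   | ‵inj₁ {i = c′} _ = <-trans (proj₂ (g-northWest c′)) πj<πi

  below-πj⇔early : ∀ b → (value b < toℕ (π at j)) ⇔ (toℕ b < k)
  below-πj⇔early b with view b
  ... | ‵fromℕ = mk⇔
    (contradiction refl ∘ <⇒≢)
    (contradiction (n<1+n k) ∘ <-asym ∘ subst (_< k) (toℕ-fromℕ (suc k)))
  ... | ‵inj₁ {i = c} _ with view c
  ...   | ‵fromℕ            = mk⇔
    (contradiction πj<πi ∘ <-asym)
    (contradiction refl ∘ <⇒≢ ∘ subst (_< k) (toℕ-penultimate k))
  ...   | ‵inj₁ {i = c′} _ = mk⇔ (λ _ → toℕ-early< c′) (λ _ → proj₂ (g-northWest c′))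

  open Standardisation value value-injective using (below?; standardise; toℕ-standardise; standardise-iso)

  τ-penultimate : ∀ a → toℕ a ≡ k → toℕ (standardise at a) ≡ suc k
  τ-penultimate a a≡k with toℕ-injective (trans a≡k (sym (toℕ-penultimate k)))
  ... | refl = trans (toℕ-standardise a) (count-all-but (below? a) (below⇒≢ , ≢⇒below))
    where
    value-penultimate : value a ≡ toℕ (π at i)
    value-penultimate = cong (λ y → toℕ (π at y)) idx-penultimate
    below⇒≢ : ∀ {b} → value b < value a → b ≢ a
    below⇒≢ vb<va b≡a = <⇒≢ vb<va (cong value b≡a)
    ≢⇒below : ∀ {b} → b ≢ a → value b < value a
    ≢⇒below {b} b≢a = subst (value b <_) (sym value-penultimate) (below-πi b b≢a)

  τ-last : ∀ a → toℕ a ≡ suc k → toℕ (standardise at a) ≡ k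
  τ-last a a≡1+k with toℕ-injective (trans a≡1+k (sym (toℕ-fromℕ (suc k))))
  ... | refl =
    trans (toℕ-standardise a) (count-initial (below? a) (m≤n+m k 2) (below⇒early , early⇒below))
    where
    value-last : value a ≡ toℕ (π at j)
    value-last = cong (λ y → toℕ (π at y)) idx-last
    below⇒early : ∀ {b} → value b < value a → toℕ b < k
    below⇒early {b} = Equivalence.to (below-πj⇔early b) ∘ subst (value b <_) value-last
    early⇒below : ∀ {b} → toℕ b < k → value b < value a
    early⇒below {b} = subst (value b <_) (sym value-last) ∘ Equivalence.from (below-πj⇔early b)

  isAPair : IsAPair (2 + k) π (i , j)
  isAPair =
    i<j , standardise , (τ-penultimate , τ-last) , idx , (idx-increasing , standardise-iso) ,
    (penultimate k , toℕ-penultimate k , idx-penultimate) , (fromℕ (suc k) , toℕ-fromℕ (suc k) , idx-last)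

isRankedInversion⇒isAPair : ∀ {k n} {π : Permutation′ n} {x} →
  IsRankedInversion k π x → IsAPair (2 + k) π x
isRankedInversion⇒isAPair {k} {π = π} {i , j} (i<j , πj<πi , k≤rank)
  with g , g-increasing , g-northWest ←
         increasing-selection (northWest? π i (π at j)) (subst (k ≤_) (rank≡count π i (π at j)) k≤rank)
  = OccurrenceOfRankedInversion.isAPair π i<j πj<πi g g-increasing g-northWest

isRankedInversion⇔isHighRankSquare : ∀ {k n} (π : Permutation′ n) i j →
  IsRankedInversion k π (i , j) ⇔ IsHighRankSquare (2 + k) π (i , π at j)
isRankedInversion⇔isHighRankSquare {k} π i j = mk⇔
  (λ (i<j , πj<πi , k≤rank) →
    (πj<πi , subst (λ y → toℕ i < toℕ y) (sym (inverseˡ π)) i<j) ,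
    subst (2 + k ≤_) (+-comm 2 _) (s≤s (s≤s k≤rank)))
  (λ ((πj<πi , i<π⁻¹πj) , 2+k≤rank+2) →
    subst (λ y → toℕ i < toℕ y) (inverseˡ π) i<π⁻¹πj , πj<πi ,
    s≤s⁻¹ (s≤s⁻¹ (subst (2 + k ≤_) (+-comm _ 2) 2+k≤rank+2)))

isAPair⇔isHighRankSquare : ∀ {k n} (π : Permutation′ n) i j →
  IsAPair (2 + k) π (i , j) ⇔ IsHighRankSquare (2 + k) π (i , π at j)
isAPair⇔isHighRankSquare {k} π i j = isRankedInversion⇔isHighRankSquare π i j ⇔-∘
  mk⇔ (isAPair⇒isRankedInversion {k} {π = π}) (isRankedInversion⇒isAPair {k} {π = π})

isHighRankSquare? : ∀ m {n} (π : Permutation′ n) → Decidable (IsHighRankSquare m π)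
isHighRankSquare? m π (i , j) =
  ((toℕ j <? toℕ (π at i)) ×-dec (toℕ i <? toℕ (π ⟨$⟩ˡ j))) ×-dec (m ≤? rank π i j + 2)

hasCard-filter : ∀ {A : Set} {P : Pred A 0ℓ} (P? : Decidable P) {xs : List A} →
  Unique xs → (∀ x → x ∈ xs) → HasCard P (length (filter P? xs))
hasCard-filter P? {xs} xs-unique xs-complete =
  filter P? xs , filter⁺ P? xs-unique , refl ,
  λ x → mk⇔ (proj₂ ∘ ∈-filter⁻ P? {xs = xs}) (∈-filter⁺ P? (xs-complete x))

hasCard-↔ : ∀ {A B : Set} {P : Pred A 0ℓ} {Q : Pred B 0ℓ} (f : A ↔ B) →
  (∀ x → P x ⇔ Q (Inverse.to f x)) → ∀ {k} → HasCard Q k → HasCard P k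
hasCard-↔ {P = P} {Q} f P⇔Q∘f (ys , ys-unique , refl , ys-complete) =
  map from ys , map⁺ (Injection.injective (↔⇒↣ (↔-sym f))) ys-unique , length-map from ys ,
  λ x → mk⇔ (∈⇒P x) (P⇒∈ x)
  where
  open Inverse f using (to; from; strictlyInverseˡ; strictlyInverseʳ)
  ∈⇒P : ∀ x → x ∈ map from ys → P x
  ∈⇒P x x∈ with y , y∈ys , refl ← ∈-map⁻ from x∈ =
    Equivalence.from (P⇔Q∘f (from y))
      (subst Q (sym (strictlyInverseˡ y)) (Equivalence.to (ys-complete y) y∈ys))
  P⇒∈ : ∀ x → P x → x ∈ map from ys
  P⇒∈ x Px = subst (_∈ map from ys) (strictlyInverseʳ x)
    (∈-map⁺ from (Equivalence.from (ys-complete (to x)) (Equivalence.to (P⇔Q∘f x) Px)))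

hasCard⇒empty⇔zero : ∀ {A : Set} {P : Pred A 0ℓ} {k} → HasCard P k → Empty P ⇔ (k ≡ 0)
hasCard⇒empty⇔zero ([]    , _ , refl , complete) =
  mk⇔ (λ _ → refl) (λ _ x Px → ¬Any[] (Equivalence.from (complete x) Px))
hasCard⇒empty⇔zero (x ∷ _ , _ , refl , complete) =
  mk⇔ (λ none → contradiction (Equivalence.to (complete x) (here refl)) (none x)) λ ()

avoidsA⇔noAPair : ∀ {k n} (π : Permutation′ n) → AvoidsA (2 + k) π ⇔ Empty (IsAPair (2 + k) π)
avoidsA⇔noAPair {k} π = mk⇔
  (λ avoids x (_ , τ , τ∈A , idx , occurrence , _) → avoids τ τ∈A (idx , occurrence))
  (λ noAPair τ τ∈A (idx , occurrence) → noAPair (idx (penultimate k) , idx (fromℕ (suc k)))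
    ( proj₁ occurrence _ _ (subst₂ _<_ (sym (toℕ-penultimate k)) (sym (toℕ-fromℕ (suc k))) (n<1+n k))
    , τ , τ∈A , idx , occurrence
    , (penultimate k , toℕ-penultimate k , refl) , (fromℕ (suc k) , toℕ-fromℕ (suc k) , refl)))

empty⇔rankBounded : ∀ m {n} (π : Permutation′ n) →
  Empty (IsHighRankSquare m π) ⇔ (∀ i j → IsDiagramSquare π i j → rank π i j + 3 ≤ m)
empty⇔rankBounded m π = mk⇔
  (λ none i j square →
    subst (_≤ m) (sym (+-suc (rank π i j) 2)) (≰⇒> λ m≤rank+2 → none (i , j) (square , m≤rank+2)))
  (λ bounded (i , j) (square , m≤rank+2) →
    1+n≰n (subst (_≤ rank π i j + 2) (+-suc (rank π i j) 2) (≤-trans (bounded i j square) m≤rank+2)))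

proposition1 : (m n : ℕ) → 2 ≤ m → 1 ≤ n → (π : Permutation′ n) →
    (Σ ℕ λ k → AmCount m π k × HasCard (IsHighRankSquare m π) k) ×
    (AvoidsA m π ⇔ (∀ (i j : Fin n) → IsDiagramSquare π i j → rank π i j + 3 ≤ m))
proposition1 (suc (suc k)) n (s≤s (s≤s z≤n)) _ π =
  (_ , aPairs , squares) ,
  (begin
    AvoidsA (2 + k) π                  ≈⟨ avoidsA⇔noAPair π ⟩
    Empty (IsAPair (2 + k) π)          ≈⟨ hasCard⇒empty⇔zero aPairs ⟩
    (_ ≡ 0)                            ≈⟨ hasCard⇒empty⇔zero squares ⟨
    Empty (IsHighRankSquare (2 + k) π) ≈⟨ empty⇔rankBounded (2 + k) π ⟩
    (∀ i j → IsDiagramSquare π i j → rank π i j + 3 ≤ 2 + k) ∎)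
  where
  open SetoidReasoning (⇔-setoid 0ℓ)
  squares : HasCard (IsHighRankSquare (2 + k) π) _
  squares = hasCard-filter (isHighRankSquare? (2 + k) π) (cartesianProduct⁺ (allFin⁺ n) (allFin⁺ n))
    (λ (i , j) → ∈-cartesianProduct⁺ (∈-allFin i) (∈-allFin j))
  aPairs : AmCount (2 + k) π _
  aPairs = hasCard-↔ (↔-id _ ×-↔ π) (λ (i , j) → isAPair⇔isHighRankSquare π i j) squares
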